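{- Let $n$, $k$, $t$ and $s$ be positive integers with $k\geq t+2$ and $n\geq 3\binom{t+2}{2}\left((k-t+1)^{2}+s\right)$. Define $$h(n,k,t,s)=\left|\left\{F\in\binom{[n]}{k}: [t]\subseteq F,\ |F\cap [k+1]|\geq t+1\right\}\right|+s+\min\{t,s\}.$$ Then $$h(n,k,t,s)>(k-t+1)\binom{n-t-1}{k-t-1}-\binom{k-t+1}{2}\binom{n-t-2}{k-t-2} \geq\frac{17}{18}(k-t+1)\binom{n-t-1}{k-t-1}.$$
   Context: $[m]=\{1,\dots,m\}$ and $\binom{[n]}{k}$ is the family of $k$-subsets of $[n]$. (The quantity $h(n,k,t,s)$ is the size of the family $\left\{F\in\binom{[n]}{k}: [t]\subseteq F,\ |F\cap [k+1]|\geq t+1\right\}\cup\mathcal{A}\cup\mathcal{B}$ with $\mathcal{A}$ an $s$-subset of $\{F\in\binom{[n]}{k}: F\cap[k+1]=[t]\}$ and $\mathcal{B}$ a $\min\{t,s\}$-subset of $\{F\in\binom{[k+1]}{k}:[t]\not\subseteq F\}$.) -}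

module Defs where

open import Data.Nat using (ℕ; zero; suc; _+_; _≤_; _<ᵇ_; _⊓_)
import Data.Nat.Properties as ℕP
open import Data.Bool using (if_then_else_)
open import Data.Fin using (Fin; toℕ)
open import Data.Fin.Subset using (Subset; Side; inside; outside; _⊆_; _∩_; ∣_∣)
open import Data.Fin.Subset.Properties using (_⊆?_)
open import Data.Vec using (Vec; []; _∷_; tabulate)
open import Data.List using (List; []; _∷_; _++_; map; filter; length)
open import Data.Product using (_×_)
open import Relation.Nullary.Decidable using (Dec; _×-dec_)
open import Relation.Binary.PropositionalEquality using (_≡_)

-- All subsets of [n] (as subsets of Fin n, where element i+1 of [n] is index i).
allSubsets : (n : ℕ) → List (Subset n)
allSubsets zero = [] ∷ []
allSubsets (suc n) = map (outside ∷_) (allSubsets n) ++ map (inside ∷_) (allSubsets n)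

-- The initial segment [m] = {1,…,m} ∩ [n], as a subset of Fin n (index i ↔ element i+1).
initSeg : {n : ℕ} → ℕ → Subset n
initSeg m = tabulate (λ i → if toℕ i <ᵇ m then inside else outside)

InFamily : (n k t : ℕ) → Subset n → Set
InFamily n k t F = (∣ F ∣ ≡ k) × (initSeg t ⊆ F) × (suc t ≤ ∣ F ∩ initSeg (suc k) ∣)

inFamily? : (n k t : ℕ) → (F : Subset n) → Dec (InFamily n k t F)
inFamily? n k t F = (∣ F ∣ ℕP.≟ k) ×-dec ((initSeg t ⊆? F) ×-dec (suc t ℕP.≤? ∣ F ∩ initSeg (suc k) ∣))

familySize : (n k t : ℕ) → ℕ
familySize n k t = length (filter (inFamily? n k t) (allSubsets n))

h : (n k t s : ℕ) → ℕ
h n k t s = familySize n k t + s + (t ⊓ s)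

-- Every set of the family contains [t], so deleting [t] identifies it with the
-- (k−t)-subsets of an (n−t)-set that meet the fixed set [k−t+1].  Truncating
-- inclusion–exclusion after two terms bounds their number from below by
-- (k−t+1)·C(n−t−1,k−t−1) − C(k−t+1,2)·C(n−t−2,k−t−2), and h exceeds the family
-- by s ≥ 1.  The absorption identity (j+1)·C(m+1,j+1) = (m+1)·C(m,j) turns the
-- ratio of the two terms into (k−t)(k−t−1)/(2(n−t−1)), which the hypothesis on n
-- makes at most 1/18.

module Submission where

open import Defs
open import Data.Nat using (ℕ; zero; suc; _+_; _*_; _∸_; _≤_; _<_; z≤n; s≤s; s≤s⁻¹)
open import Data.Nat.Properties
open import Data.Nat.Combinatorics using (_C_; nC1≡n; nCn≡1; nCk≡nC[n∸k]; nCk+nC[k+1]≡[n+1]C[k+1])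
open import Data.Integer using (+_)
import Data.Nat as N
import Data.Integer as Z
import Data.Integer.Properties as ℤ
open import Data.Nat.Tactic.RingSolver using (solve-∀)
open import Algebra.Properties.CommutativeSemigroup *-commutativeSemigroup using (x∙yz≈y∙xz)
open import Data.Fin using (zero; suc)
open import Data.Fin.Subset using (Subset; inside; outside; _∈_; _⊆_; _∩_; ∣_∣)
open import Data.Fin.Subset.Properties using (_⊆?_; drop-∷-⊆; s⊆s; out⊆)
open import Data.List using (List; []; _∷_; _++_; map; filter; length)
open import Data.Vec using ([]; _∷_; here)
open import Data.List.Properties using (length-++; filter-++; filter-≐; filter-none)
import Data.List.Relation.Unary.All as All
open import Data.Product using (_×_; _,_; proj₁; proj₂)
open import Data.Sum using (inj₁; inj₂)
open import Level using (Level)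
open import Relation.Nullary using (¬_; yes; no)
open import Relation.Nullary.Decidable using (_×-dec_)
open import Relation.Unary using (Pred; Decidable; _≐_)
open import Relation.Binary.PropositionalEquality
  using (_≡_; refl; sym; trans; cong; cong₂; subst; module ≡-Reasoning)

private
  variable
    ℓ : Level
    A B : Set

count : {P : Pred A ℓ} → Decidable P → List A → ℕ
count P? xs = length (filter P? xs)

count-≐ : {P Q : Pred A ℓ} (P? : Decidable P) (Q? : Decidable Q) → P ≐ Q →
  ∀ xs → count P? xs ≡ count Q? xs
count-≐ P? Q? P≐Q xs = cong length (filter-≐ P? Q? P≐Q xs)

count-none : {P : Pred A ℓ} (P? : Decidable P) → (∀ x → ¬ P x) → ∀ xs → count P? xs ≡ 0
count-none P? ¬P xs = cong length (filter-none P? (All.universal ¬P xs))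

count-++ : {P : Pred A ℓ} (P? : Decidable P) → ∀ xs ys →
  count P? (xs ++ ys) ≡ count P? xs + count P? ys
count-++ P? xs ys = trans (cong length (filter-++ P? xs ys)) (length-++ (filter P? xs))

count-map : {P : Pred B ℓ} (P? : Decidable P) (f : A → B) → ∀ xs →
  count P? (map f xs) ≡ count (λ x → P? (f x)) xs
count-map P? f [] = refl
count-map P? f (x ∷ xs) with P? (f x)
... | yes _ = cong suc (count-map P? f xs)
... | no _ = count-map P? f xs

count-allSubsets-suc : ∀ {n} {P : Pred (Subset (suc n)) ℓ} (P? : Decidable P) →
  count P? (allSubsets (suc n)) ≡
    count (λ F → P? (outside ∷ F)) (allSubsets n) + count (λ F → P? (inside ∷ F)) (allSubsets n)
count-allSubsets-suc {n = n} P? =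
  trans (count-++ P? (map (outside ∷_) (allSubsets n)) _)
        (cong₂ _+_ (count-map P? (outside ∷_) (allSubsets n)) (count-map P? (inside ∷_) (allSubsets n)))

#OfSize : ℕ → ℕ → ℕ
#OfSize n k = count (λ F → ∣ F ∣ ≟ k) (allSubsets n)

nC0≡1 : ∀ n → n C 0 ≡ 1
nC0≡1 n = trans (nCk≡nC[n∸k] {n = n} z≤n) (nCn≡1 n)

#OfSize≡C : ∀ n k → #OfSize n k ≡ n C k
#OfSize≡C zero zero = refl
#OfSize≡C zero (suc k) = refl
#OfSize≡C (suc n) k = trans (count-allSubsets-suc {n = n} (λ F → ∣ F ∣ ≟ k)) (split k)
  where
  split : ∀ k → #OfSize n k + count (λ F → ∣ inside ∷ F ∣ ≟ k) (allSubsets n) ≡ suc n C k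
  split zero = trans (cong₂ _+_ (trans (#OfSize≡C n 0) (nC0≡1 n)) (count-none _ (λ F ()) (allSubsets n)))
                     (sym (nC0≡1 (suc n)))
  split (suc k) = begin
    #OfSize n (suc k) + count (λ F → ∣ inside ∷ F ∣ ≟ suc k) (allSubsets n)
      ≡⟨ cong₂ _+_ refl (count-≐ _ _ (suc-injective , cong suc) (allSubsets n)) ⟩
    #OfSize n (suc k) + #OfSize n k ≡⟨ cong₂ _+_ (#OfSize≡C n (suc k)) (#OfSize≡C n k) ⟩
    n C suc k + n C k                ≡⟨ +-comm (n C suc k) (n C k) ⟩
    n C k + n C suc k                ≡⟨ nCk+nC[k+1]≡[n+1]C[k+1] n k ⟩
    suc n C suc k ∎
    where open ≡-Reasoning

-- InFamily n k t is Family n k t (suc k) (suc t); the extra parameters let the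
-- forced points [t] be stripped off one at a time.
Family : (n k t c r : ℕ) → Subset n → Set
Family n k t c r F = (∣ F ∣ ≡ k) × (initSeg t ⊆ F) × (r ≤ ∣ F ∩ initSeg c ∣)

family? : (n k t c r : ℕ) → Decidable (Family n k t c r)
family? n k t c r F = (∣ F ∣ ≟ k) ×-dec ((initSeg t ⊆? F) ×-dec (r ≤? ∣ F ∩ initSeg c ∣))

#Family : (n k t c r : ℕ) → ℕ
#Family n k t c r = count (family? n k t c r) (allSubsets n)

#Meeting : (n c k : ℕ) → ℕ
#Meeting n c k = #Family n k 0 c 1

initSeg0⊆ : ∀ {n} (F : Subset n) → initSeg 0 ⊆ F
initSeg0⊆ [] {()}
initSeg0⊆ (_ ∷ F) = out⊆ (initSeg0⊆ F)

#Family-drop-first : ∀ n k t c r →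
  #Family (suc n) (suc k) (suc t) (suc c) (suc r) ≡ #Family n k t c r
#Family-drop-first n k t c r =
  trans (count-allSubsets-suc {n = n} (family? (suc n) (suc k) (suc t) (suc c) (suc r)))
        (cong₂ _+_ (count-none _ (λ F F∈ → 0∉ (proj₁ (proj₂ F∈) here)) (allSubsets n))
                   (count-≐ _ _ (drop , add) (allSubsets n)))
  where
  0∉ : ∀ {F : Subset n} → ¬ (zero ∈ outside ∷ F)
  0∉ ()
  drop : ∀ {F} → Family (suc n) (suc k) (suc t) (suc c) (suc r) (inside ∷ F) → Family n k t c r F
  drop (∣F∣ , ⊆F , r≤) = suc-injective ∣F∣ , drop-∷-⊆ ⊆F , s≤s⁻¹ r≤
  add : ∀ {F} → Family n k t c r F → Family (suc n) (suc k) (suc t) (suc c) (suc r) (inside ∷ F)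
  add (∣F∣ , ⊆F , r≤) = cong suc ∣F∣ , s⊆s ⊆F , s≤s r≤

#Family-drop-prefix : ∀ t {n k c r} → #Family (t + n) (t + k) t (t + c) (t + r) ≡ #Family n k 0 c r
#Family-drop-prefix zero = refl
#Family-drop-prefix (suc t) {n} {k} {c} {r} =
  trans (#Family-drop-first (t + n) (t + k) t (t + c) (t + r)) (#Family-drop-prefix t)

familySize≡#Meeting : ∀ {n k t} → t ≤ n → t ≤ k → familySize n k t ≡ #Meeting (n ∸ t) (k ∸ t + 1) (k ∸ t)
familySize≡#Meeting {n} {k} {t} t≤n t≤k = begin
  familySize n k t
    ≡⟨ cong₂ (λ n k → familySize n k t) (sym (m+[n∸m]≡n t≤n)) (sym (m+[n∸m]≡n t≤k)) ⟩
  #Family (t + (n ∸ t)) (t + (k ∸ t)) t (suc (t + (k ∸ t))) (suc t)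
    ≡⟨ cong₂ (#Family (t + (n ∸ t)) (t + (k ∸ t)) t) (trans (+-comm 1 (t + (k ∸ t))) (+-assoc t (k ∸ t) 1)) (+-comm 1 t) ⟩
  #Family (t + (n ∸ t)) (t + (k ∸ t)) t (t + (k ∸ t + 1)) (t + 1)
    ≡⟨ #Family-drop-prefix t ⟩
  #Meeting (n ∸ t) (k ∸ t + 1) (k ∸ t) ∎
  where open ≡-Reasoning

#Meeting-suc : ∀ n c k → #Meeting (suc n) (suc c) (suc k) ≡ #Meeting n c (suc k) + n C k
#Meeting-suc n c k =
  trans (count-allSubsets-suc {n = n} (family? (suc n) (suc k) 0 (suc c) 1))
        (cong₂ _+_ (count-≐ _ _ (drop-outside , add-outside) (allSubsets n))
                   (trans (count-≐ _ _ (drop-inside , add-inside) (allSubsets n)) (#OfSize≡C n k)))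
  where
  drop-outside : ∀ {F} → Family (suc n) (suc k) 0 (suc c) 1 (outside ∷ F) → Family n (suc k) 0 c 1 F
  drop-outside {F} (∣F∣ , _ , 1≤) = ∣F∣ , initSeg0⊆ F , 1≤
  add-outside : ∀ {F} → Family n (suc k) 0 c 1 F → Family (suc n) (suc k) 0 (suc c) 1 (outside ∷ F)
  add-outside {F} (∣F∣ , _ , 1≤) = ∣F∣ , initSeg0⊆ (outside ∷ F) , 1≤
  drop-inside : ∀ {F} → Family (suc n) (suc k) 0 (suc c) 1 (inside ∷ F) → ∣ F ∣ ≡ k
  drop-inside (∣F∣ , _) = suc-injective ∣F∣
  add-inside : ∀ {F} → ∣ F ∣ ≡ k → Family (suc n) (suc k) 0 (suc c) 1 (inside ∷ F)
  add-inside {F} ∣F∣ = cong suc ∣F∣ , initSeg0⊆ (inside ∷ F) , s≤s z≤n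

[1+k]*[1+n]C[1+k]≡[1+n]*nCk : ∀ n k → suc k * (suc n C suc k) ≡ suc n * (n C k)
[1+k]*[1+n]C[1+k]≡[1+n]*nCk zero zero = refl
[1+k]*[1+n]C[1+k]≡[1+n]*nCk zero (suc k) = *-zeroʳ (suc (suc k))
[1+k]*[1+n]C[1+k]≡[1+n]*nCk (suc n) zero = begin
  1 * (suc (suc n) C 1)  ≡⟨ *-identityˡ _ ⟩
  suc (suc n) C 1        ≡⟨ nC1≡n (suc (suc n)) ⟩
  suc (suc n)            ≡⟨ *-identityʳ (suc (suc n)) ⟨
  suc (suc n) * 1        ≡⟨ cong (suc (suc n) *_) (nC0≡1 (suc n)) ⟨
  suc (suc n) * (suc n C 0) ∎
  where open ≡-Reasoning
[1+k]*[1+n]C[1+k]≡[1+n]*nCk (suc n) (suc k) = begin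
  suc (suc k) * (suc (suc n) C suc (suc k))
    ≡⟨ cong (suc (suc k) *_) (nCk+nC[k+1]≡[n+1]C[k+1] (suc n) (suc k)) ⟨
  suc (suc k) * (suc n C suc k + suc n C suc (suc k))
    ≡⟨ split-factor k (suc n C suc k) (suc n C suc (suc k)) ⟩
  suc k * (suc n C suc k) + suc n C suc k + suc (suc k) * (suc n C suc (suc k))
    ≡⟨ cong₂ (λ u v → u + suc n C suc k + v) ([1+k]*[1+n]C[1+k]≡[1+n]*nCk n k)
                                             ([1+k]*[1+n]C[1+k]≡[1+n]*nCk n (suc k)) ⟩
  suc n * (n C k) + suc n C suc k + suc n * (n C suc k)
    ≡⟨ cong (λ u → suc n * (n C k) + u + suc n * (n C suc k)) (nCk+nC[k+1]≡[n+1]C[k+1] n k) ⟨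
  suc n * (n C k) + (n C k + n C suc k) + suc n * (n C suc k)
    ≡⟨ join-factor n (n C k) (n C suc k) ⟩
  suc (suc n) * (n C k + n C suc k)
    ≡⟨ cong (suc (suc n) *_) (nCk+nC[k+1]≡[n+1]C[k+1] n k) ⟩
  suc (suc n) * (suc n C suc k) ∎
  where
  open ≡-Reasoning
  split-factor : ∀ k u v → suc (suc k) * (u + v) ≡ suc k * u + u + suc (suc k) * v
  split-factor = solve-∀
  join-factor : ∀ n u v → suc n * u + (u + v) + suc n * v ≡ suc (suc n) * (u + v)
  join-factor = solve-∀

2*nC2≡n*[n∸1] : ∀ n → 2 * (n C 2) ≡ n * (n ∸ 1)
2*nC2≡n*[n∸1] zero = refl
2*nC2≡n*[n∸1] (suc n) = trans ([1+k]*[1+n]C[1+k]≡[1+n]*nCk n 1) (cong (suc n *_) (nC1≡n n))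

n≤nC2 : ∀ {n} → 3 ≤ n → n ≤ n C 2
n≤nC2 {n} 3≤n = *-cancelˡ-≤ 2 (begin
  2 * n       ≡⟨ *-comm 2 n ⟩
  n * 2       ≤⟨ *-monoʳ-≤ n (∸-monoˡ-≤ 1 3≤n) ⟩
  n * (n ∸ 1) ≡⟨ 2*nC2≡n*[n∸1] n ⟨
  2 * (n C 2) ∎)
  where open ≤-Reasoning

nCk≤[1+n]Ck : ∀ n k → n C k ≤ suc n C k
nCk≤[1+n]Ck n zero = ≤-reflexive (trans (nC0≡1 n) (sym (nC0≡1 (suc n))))
nCk≤[1+n]Ck n (suc k) = subst (n C suc k ≤_) (nCk+nC[k+1]≡[n+1]C[k+1] n k) (m≤n+m (n C suc k) (n C k))

C-monoˡ-≤ : ∀ {m n} k → m ≤ n → m C k ≤ n C k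
C-monoˡ-≤ {n = zero} k z≤n = ≤-refl
C-monoˡ-≤ {n = suc n} k m≤1+n with m≤n⇒m<n∨m≡n m≤1+n
... | inj₁ m<1+n = ≤-trans (C-monoˡ-≤ k (s≤s⁻¹ m<1+n)) (nCk≤[1+n]Ck n k)
... | inj₂ refl = ≤-refl

-- Σ_{i ∈ [c]} |{F ∋ i}| ≤ |{F meeting [c]}| + Σ_{i<j ∈ [c]} |{F ∋ i, j}| among the k-subsets F of [n].
bonferroni : ∀ {k} → 2 ≤ k → ∀ c n →
  c * ((n ∸ 1) C (k ∸ 1)) ≤ #Meeting n c k + (c C 2) * ((n ∸ 2) C (k ∸ 2))
bonferroni _ zero n = z≤n
bonferroni {suc (suc k)} (s≤s (s≤s _)) (suc c) zero = ≤-trans (≤-reflexive (*-zeroʳ (suc c))) z≤n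
bonferroni {suc (suc k)} (s≤s (s≤s _)) (suc c) (suc zero) = ≤-trans (≤-reflexive (*-zeroʳ (suc c))) z≤n
bonferroni {suc (suc k)} 2≤k@(s≤s (s≤s _)) (suc c) (suc (suc n)) = begin
  suc c * (suc n C suc k)
    ≡⟨ cong (λ u → suc n C suc k + c * u) (nCk+nC[k+1]≡[n+1]C[k+1] n k) ⟨
  suc n C suc k + c * (n C k + n C suc k)
    ≡⟨ cong₂ _+_ refl (trans (*-distribˡ-+ c (n C k) (n C suc k)) (+-comm (c * (n C k)) _)) ⟩
  suc n C suc k + (c * (n C suc k) + c * (n C k))
    ≤⟨ +-monoʳ-≤ (suc n C suc k) (+-monoˡ-≤ (c * (n C k)) (bonferroni 2≤k c (suc n))) ⟩
  suc n C suc k + (M + (c C 2) * ((n ∸ 1) C k) + c * (n C k))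
    ≤⟨ +-monoʳ-≤ (suc n C suc k) (+-monoˡ-≤ (c * (n C k)) (+-monoʳ-≤ M
         (*-monoʳ-≤ (c C 2) (C-monoˡ-≤ k (m∸n≤m n 1))))) ⟩
  suc n C suc k + (M + (c C 2) * (n C k) + c * (n C k))
    ≡⟨ regroup (suc n C suc k) M (c C 2) c (n C k) ⟩
  (M + suc n C suc k) + (c + c C 2) * (n C k)
    ≡⟨ cong₂ (λ u v → u + v * (n C k)) (sym (#Meeting-suc (suc n) c (suc k)))
             (trans (cong (_+ c C 2) (sym (nC1≡n c))) (nCk+nC[k+1]≡[n+1]C[k+1] c 1)) ⟩
  #Meeting (suc (suc n)) (suc c) (suc (suc k)) + (suc c C 2) * (n C k) ∎
  where
  open ≤-Reasoning
  M = #Meeting (suc n) c (suc (suc k))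
  regroup : ∀ x m y c z → x + (m + y * z + c * z) ≡ (m + x) + (c + y) * z
  regroup = solve-∀

C-ratio : ∀ {k n} → 2 ≤ k → 9 * (k * (k ∸ 1)) < n →
  18 * (((k + 1) C 2) * ((n ∸ 2) C (k ∸ 2))) ≤ (k + 1) * ((n ∸ 1) C (k ∸ 1))
C-ratio {k@(suc (suc j))} {suc (suc n)} (s≤s (s≤s _)) (s≤s bound) = *-cancelˡ-≤ (suc j) (begin
  suc j * (18 * (((k + 1) C 2) * (n C j)))
    ≡⟨ regroup (suc j) ((k + 1) C 2) (n C j) ⟩
  9 * suc j * (2 * ((k + 1) C 2)) * (n C j)
    ≡⟨ cong (λ u → 9 * suc j * u * (n C j)) (trans (2*nC2≡n*[n∸1] (k + 1)) (cong ((k + 1) *_) (m+n∸n≡m k 1))) ⟩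
  9 * suc j * ((k + 1) * k) * (n C j)
    ≡⟨ regroup′ (suc j) k (k + 1) (n C j) ⟩
  9 * (k * suc j) * ((k + 1) * (n C j))
    ≤⟨ *-monoˡ-≤ ((k + 1) * (n C j)) bound ⟩
  suc n * ((k + 1) * (n C j))
    ≡⟨ x∙yz≈y∙xz (suc n) (k + 1) (n C j) ⟩
  (k + 1) * (suc n * (n C j))
    ≡⟨ cong ((k + 1) *_) ([1+k]*[1+n]C[1+k]≡[1+n]*nCk n j) ⟨
  (k + 1) * (suc j * (suc n C suc j))
    ≡⟨ x∙yz≈y∙xz (k + 1) (suc j) (suc n C suc j) ⟩
  suc j * ((k + 1) * (suc n C suc j)) ∎)
  where
  open ≤-Reasoning
  regroup : ∀ j c z → j * (18 * (c * z)) ≡ 9 * j * (2 * c) * z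
  regroup = solve-∀
  regroup′ : ∀ j k l z → 9 * j * (l * k) * z ≡ 9 * (k * j) * (l * z)
  regroup′ = solve-∀

difference-bounds : ∀ {a b m h} → 18 * b ≤ a → a ≤ m + b → m < h →
  (+ a Z.- + b Z.< + h) × (+ 17 Z.* + a Z.≤ + 18 Z.* (+ a Z.- + b))
difference-bounds {a} {b} {m} {h} 18b≤a a≤m+b m<h = a-b<h , 17a≤18[a-b]
  where
  a-b≡a∸b : + a Z.- + b ≡ + (a ∸ b)
  a-b≡a∸b = trans (ℤ.m-n≡m⊖n a b) (ℤ.⊖-≥ (≤-trans (m≤n*m b 18) 18b≤a))
  a-b<h : + a Z.- + b Z.< + h
  a-b<h rewrite a-b≡a∸b = Z.+<+ (≤-<-trans (m≤n+o⇒m∸n≤o a b (≤-trans a≤m+b (≤-reflexive (+-comm m b)))) m<h)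
  17a≤18[a-b] : + 17 Z.* + a Z.≤ + 18 Z.* (+ a Z.- + b)
  17a≤18[a-b] rewrite a-b≡a∸b | sym (ℤ.pos-* 17 a) | sym (ℤ.pos-* 18 (a ∸ b)) = Z.+≤+ (begin
    17 * a            ≡⟨ m+n∸n≡m (17 * a) (18 * b) ⟨
    17 * a + 18 * b ∸ 18 * b ≤⟨ ∸-monoˡ-≤ (18 * b) (+-monoʳ-≤ (17 * a) 18b≤a) ⟩
    17 * a + a ∸ 18 * b ≡⟨ cong (_∸ 18 * b) (17a+a≡18a a) ⟩
    18 * a ∸ 18 * b   ≡⟨ *-distribˡ-∸ 18 a b ⟨
    18 * (a ∸ b) ∎)
    where
    open ≤-Reasoning
    17a+a≡18a : ∀ a → 17 * a + a ≡ 18 * a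
    17a+a≡18a = solve-∀

large⇒9x+t<n : ∀ {n t c x s} → 1 ≤ t → t + 2 ≤ c → 1 ≤ s → 3 * c * (x + s) ≤ n → suc (9 * x) + t ≤ n
large⇒9x+t<n {n} {t} {c} {x} {s} 1≤t t+2≤c 1≤s large = begin
  suc (9 * x) + t        ≤⟨ n≤1+n _ ⟩
  suc (suc (9 * x) + t)  ≡⟨ shift x t ⟩
  9 * x + (t + 2)        ≤⟨ +-mono-≤ (*-monoˡ-≤ x (*-monoʳ-≤ 3 (≤-trans (+-monoˡ-≤ 2 1≤t) t+2≤c)))
                                     (≤-trans t+2≤c (m≤n*m c 3)) ⟩
  3 * c * x + 3 * c      ≡⟨ cong₂ _+_ refl (*-identityʳ (3 * c)) ⟨
  3 * c * x + 3 * c * 1  ≡⟨ *-distribˡ-+ (3 * c) x 1 ⟨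
  3 * c * (x + 1)        ≤⟨ *-monoʳ-≤ (3 * c) (+-monoʳ-≤ x 1≤s) ⟩
  3 * c * (x + s)        ≤⟨ large ⟩
  n                      ∎
  where
  open ≤-Reasoning
  shift : ∀ x t → suc (suc (9 * x) + t) ≡ 9 * x + (t + 2)
  shift = solve-∀

lemma2p5 : (n k t s : ℕ) → 1 N.≤ n → 1 N.≤ k → 1 N.≤ t → 1 N.≤ s →
    t N.+ 2 N.≤ k →
    3 N.* ((t N.+ 2) C 2) N.* ((k N.∸ t N.+ 1) N.* (k N.∸ t N.+ 1) N.+ s) N.≤ n →
    ((+ ((k N.∸ t N.+ 1) N.* ((n N.∸ t N.∸ 1) C (k N.∸ t N.∸ 1))) Z.- + (((k N.∸ t N.+ 1) C 2) N.* ((n N.∸ t N.∸ 2) C (k N.∸ t N.∸ 2))))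
        Z.< + h n k t s)
    × (+ 17 Z.* + ((k N.∸ t N.+ 1) N.* ((n N.∸ t N.∸ 1) C (k N.∸ t N.∸ 1)))
        Z.≤ + 18 Z.* (+ ((k N.∸ t N.+ 1) N.* ((n N.∸ t N.∸ 1) C (k N.∸ t N.∸ 1))) Z.- + (((k N.∸ t N.+ 1) C 2) N.* ((n N.∸ t N.∸ 2) C (k N.∸ t N.∸ 2)))))
lemma2p5 n k t s _ _ 1≤t 1≤s t+2≤k large =
  difference-bounds (C-ratio 2≤k∸t 9[k∸t][k∸t∸1]<n∸t) (bonferroni 2≤k∸t (k ∸ t + 1) (n ∸ t)) #Meeting<h
  where
  2≤k∸t : 2 ≤ k ∸ t
  2≤k∸t = m+n≤o⇒m≤o∸n 2 (subst (_≤ k) (+-comm t 2) t+2≤k)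
  room : suc (9 * ((k ∸ t + 1) * (k ∸ t + 1))) + t ≤ n
  room = large⇒9x+t<n 1≤t (n≤nC2 (+-monoˡ-≤ 2 1≤t)) 1≤s large
  9[k∸t][k∸t∸1]<n∸t : 9 * ((k ∸ t) * (k ∸ t ∸ 1)) < n ∸ t
  9[k∸t][k∸t∸1]<n∸t = ≤-trans (s≤s (*-monoʳ-≤ 9 (*-mono-≤ (m≤m+n (k ∸ t) 1)
                        (≤-trans (m∸n≤m (k ∸ t) 1) (m≤m+n (k ∸ t) 1))))) (m+n≤o⇒m≤o∸n _ room)
  #Meeting<h : #Meeting (n ∸ t) (k ∸ t + 1) (k ∸ t) < h n k t s
  #Meeting<h = subst (_< h n k t s) (familySize≡#Meeting (≤-trans (m≤n+m t _) room) (m+n≤o⇒m≤o t t+2≤k))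
                 (≤-trans (m<m+n (familySize n k t) 1≤s) (m≤m+n _ (t N.⊓ s)))
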